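{- If $D$ is a finite simple digraph with $\gamma_I(D)=3$ and $\gamma(D)=2$, then $r(D)\leq r_I(D)+1$.
   Context: A finite simple digraph has no loops and no multiple arcs (oppositely oriented arcs allowed). A set $S\subseteq V(D)$ is a dominating set if every vertex of $D$ is in $S$ or is an out-neighbor of some vertex of $S$; the domination number $\gamma(D)$ is the minimum size of a dominating set. For a set $R$ of arcs not in $A(D)$ (between distinct vertices), $D+R$ is $D$ with these arcs added. The reinforcement number $r(D)$ is the minimum number of extra arcs whose addition to $D$ yields a digraph $D'$ with $\gamma(D')<\gamma(D)$. An Italian dominating function (IDF) on $D$ is a function $f:V(D)\to\{0,1,2\}$ such that every vertex $v$ with $f(v)=0$ has at least two in-neighbors $w$ with $f(w)=1$ or at least one in-neighbor $w$ with $f(w)=2$; its weight is $\sum_u f(u)$ and $\gamma_I(D)$ is the minimum weight of an IDF. The Italian reinforcement number $r_I(D)$ is the minimum number of extra arcs whose addition to $D$ yields a digraph $D'$ with $\gamma_I(D')<\gamma_I(D)$ (defined to be $0$ if $\gamma_I(D)\leq 2$). -}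

module Defs where

open import Data.Nat using (ℕ; zero; suc; _+_; _≤_; _<_)
open import Data.Bool using (Bool; true; false; _∧_; not; if_then_else_)
open import Data.Fin using (Fin)
open import Data.Fin.Subset using (Subset; _∈_; ∣_∣)
open import Data.List using (List; map; allFin)
open import Data.Nat.ListAction using (sum)
open import Data.Product using (Σ; ∃; ∃-syntax; _×_; _,_)
open import Data.Sum using (_⊎_)
open import Relation.Binary.PropositionalEquality using (_≡_; _≢_)

-- A digraph on the vertex set Fin n, given by its arc relation (Bool-valued).
-- Multiple arcs are impossible by construction; opposite arcs are allowed.
Digraph : ℕ → Set
Digraph n = Fin n → Fin n → Bool

Arc : ∀ {n} → Digraph n → Fin n → Fin n → Set
Arc D u v = D u v ≡ true

-- simple = no loops
Loopless : ∀ {n} → Digraph n → Set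
Loopless D = ∀ v → D v v ≡ false

IsMin : (ℕ → Set) → ℕ → Set
IsMin P k = P k × (∀ m → P m → k ≤ m)

sumFin : ∀ n → (Fin n → ℕ) → ℕ
sumFin n f = sum (map f (allFin n))

Dominating : ∀ {n} → Digraph n → Subset n → Set
Dominating {n} D S = ∀ (v : Fin n) → v ∈ S ⊎ (∃[ u ] (u ∈ S × Arc D u v))

HasDomSetOfSize : ∀ {n} → Digraph n → ℕ → Set
HasDomSetOfSize D k = ∃[ S ] (Dominating D S × ∣ S ∣ ≡ k)

IsDomNum : ∀ {n} → Digraph n → ℕ → Set
IsDomNum D k = IsMin (HasDomSetOfSize D) k

IsIDF : ∀ {n} → Digraph n → (Fin n → ℕ) → Set
IsIDF {n} D f =
  (∀ v → f v ≤ 2) ×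
  (∀ (v : Fin n) → f v ≡ 0 →
     (∃[ w ] (Arc D w v × f w ≡ 2)) ⊎
     (∃[ w₁ ] ∃[ w₂ ] (w₁ ≢ w₂ × Arc D w₁ v × Arc D w₂ v × f w₁ ≡ 1 × f w₂ ≡ 1)))

weight : ∀ {n} → (Fin n → ℕ) → ℕ
weight {n} f = sumFin n f

HasIDFOfWeight : ∀ {n} → Digraph n → ℕ → Set
HasIDFOfWeight D k = ∃[ f ] (IsIDF D f × weight f ≡ k)

IsItalNum : ∀ {n} → Digraph n → ℕ → Set
IsItalNum D k = IsMin (HasIDFOfWeight D) k

-- Adding arcs.  D' = D + R for a set R of non-arcs (between distinct
-- vertices) exactly when D' is loopless and contains D; then |R| is the
-- number of arcs of D' not in D.

_⊆ᴰ_ : ∀ {n} → Digraph n → Digraph n → Set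
D ⊆ᴰ D' = ∀ u v → Arc D u v → Arc D' u v

addedArcs : ∀ {n} → Digraph n → Digraph n → ℕ
addedArcs {n} D D' =
  sumFin n (λ u → sumFin n (λ v → if D' u v ∧ not (D u v) then 1 else 0))

IsExtension : ∀ {n} → Digraph n → Digraph n → ℕ → Set
IsExtension D D' m = Loopless D' × D ⊆ᴰ D' × addedArcs D D' ≡ m

IsReinfNum : ∀ {n} → Digraph n → ℕ → Set
IsReinfNum {n} D r = IsMin
  (λ m → ∃[ D' ] (IsExtension D D' m ×
     (∃[ a ] ∃[ b ] (IsDomNum D' a × IsDomNum D b × a < b)))) r

-- r_I(D) = r  (0 when γ_I(D) ≤ 2)
IsItalReinfNum : ∀ {n} → Digraph n → ℕ → Set
IsItalReinfNum {n} D r =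
  (∃[ g ] (IsItalNum D g × g ≤ 2 × r ≡ 0)) ⊎
  (∃[ g ] (IsItalNum D g × 2 < g × IsMin
     (λ m → ∃[ D' ] (IsExtension D D' m ×
        (∃[ a ] (IsItalNum D' a × a < g)))) r))

module Submission where

-- Adding rI arcs to D gives a digraph D' with γ_I(D') ≤ 2.  An Italian
-- dominating function of weight at most 2 on D' either puts 2 on one vertex w,
-- which then dominates D' alone, or puts 1 on two vertices u, v that are both
-- in-neighbours of every other vertex; adding the arc uv (if absent) makes u
-- dominate.  So at most rI + 1 added arcs bring γ from 2 down to 1.

open import Defs
open import Data.Nat using (ℕ; zero; suc; _+_; _≤_; z≤n; s≤s)
open import Data.Nat.Properties
  using ( ≤-refl; ≤-trans; ≤-antisym; m≤m+n; +-monoʳ-≤; +-cancelˡ-≤; n≤0⇒n≡0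
        ; +-comm; ≤-pred; module ≤-Reasoning; +-0-commutativeMonoid )
open import Data.Bool using (true; false; _∧_; _∨_; not; if_then_else_)
open import Data.Bool.Properties using (∨-identityʳ; ∨-zeroʳ; ∧-zeroʳ)
open import Data.Fin using (Fin; zero; suc; _≟_; punchIn; punchOut)
open import Data.Fin.Properties using (punchInᵢ≢i; punchIn-punchOut; punchOut-injective)
open import Data.Fin.Subset using (Subset; _∈_; ∣_∣; ⁅_⁆; ⊤)
open import Data.Fin.Subset.Properties using (x∈⁅x⁆; ∣⁅x⁆∣≡1; ∈⊤; ∣⊤∣≡n; x∈p⇒∣p-x∣<∣p∣)
open import Data.List using (map; tabulate)
open import Data.List.Properties using (map-tabulate)
open import Data.Vec.Functional using (removeAt)
open import Algebra.Properties.CommutativeMonoid.Sum +-0-commutativeMonoid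
  using (sum; sum-remove; sum-cong-≗)
import Data.Nat.ListAction as List
open import Data.Product using (∃₂; ∃-syntax; _×_; _,_; proj₁; proj₂)
open import Data.Sum using (_⊎_; inj₁; inj₂)
open import Function using (_∘_; id)
open import Relation.Nullary using (yes; no; does; contradiction)
open import Relation.Nullary.Decidable using (dec-true; dec-false)
open import Relation.Binary.PropositionalEquality
  using (_≡_; _≢_; refl; sym; trans; cong; cong₂; subst; module ≡-Reasoning)

sumFin≡sum : ∀ n (f : Fin n → ℕ) → sumFin n f ≡ sum f
sumFin≡sum zero    f = refl
sumFin≡sum (suc n) f = cong (f zero +_) (begin
  List.sum (map f (tabulate suc))  ≡⟨ cong List.sum (map-tabulate suc f) ⟩
  List.sum (tabulate (f ∘ suc))    ≡⟨ cong List.sum (map-tabulate id (f ∘ suc)) ⟨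
  sumFin n (f ∘ suc)               ≡⟨ sumFin≡sum n (f ∘ suc) ⟩
  sum (f ∘ suc)                    ∎)
  where open ≡-Reasoning

sum-lookup-≤ : ∀ {n} (f : Fin n → ℕ) i → f i ≤ sum f
sum-lookup-≤ {suc n} f i = subst (f i ≤_) (sym (sum-remove {i = i} f)) (m≤m+n (f i) _)

sum-pair-≤ : ∀ {n} (f : Fin n → ℕ) {i j} → i ≢ j → f i + f j ≤ sum f
sum-pair-≤ {suc n} f {i} {j} i≢j = begin
  f i + f j                          ≡⟨ cong (λ k → f i + f k) (punchIn-punchOut i≢j) ⟨
  f i + removeAt f i (punchOut i≢j)  ≤⟨ +-monoʳ-≤ (f i) (sum-lookup-≤ (removeAt f i) _) ⟩
  f i + sum (removeAt f i)           ≡⟨ sum-remove f ⟨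
  sum f                              ∎
  where open ≤-Reasoning

sum-triple-≤ : ∀ {n} (f : Fin n → ℕ) {i j k} → i ≢ j → i ≢ k → j ≢ k →
               f i + (f j + f k) ≤ sum f
sum-triple-≤ {suc n} f {i} {j} {k} i≢j i≢k j≢k = begin
  f i + (f j + f k)
    ≡⟨ cong₂ (λ a b → f i + (f a + f b)) (punchIn-punchOut i≢j) (punchIn-punchOut i≢k) ⟨
  f i + (g (punchOut i≢j) + g (punchOut i≢k))
    ≤⟨ +-monoʳ-≤ (f i) (sum-pair-≤ g (j≢k ∘ punchOut-injective i≢j i≢k)) ⟩
  f i + sum g
    ≡⟨ sum-remove f ⟨
  sum f
    ∎
  where
  open ≤-Reasoning
  g = removeAt f i

sum-suc-at : ∀ {n} (f g : Fin n → ℕ) {i} → (∀ j → j ≢ i → g j ≡ f j) → g i ≡ suc (f i) →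
             sum g ≡ suc (sum f)
sum-suc-at {suc n} f g {i} g≡f g≡1+f = begin
  sum g                            ≡⟨ sum-remove g ⟩
  g i + sum (removeAt g i)         ≡⟨ cong₂ _+_ g≡1+f (sum-cong-≗ g≡f-off) ⟩
  suc (f i) + sum (removeAt f i)   ≡⟨ cong suc (sum-remove f) ⟨
  suc (sum f)                      ∎
  where
  open ≡-Reasoning
  g≡f-off : ∀ j → g (punchIn i j) ≡ f (punchIn i j)
  g≡f-off j = g≡f (punchIn i j) (punchInᵢ≢i i j)

IsMin-unique : ∀ {P : ℕ → Set} {a b} → IsMin P a → IsMin P b → a ≡ b
IsMin-unique (Pa , a-min) (Pb , b-min) = ≤-antisym (a-min _ Pb) (b-min _ Pa)

Dominator : ∀ {n} → Digraph n → Fin n → Set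
Dominator D w = ∀ x → x ≡ w ⊎ Arc D w x

domNum-≤-order : ∀ {n} {D : Digraph n} {k} → IsDomNum D k → k ≤ n
domNum-≤-order {n} (_ , k-min) = k-min n (⊤ , (λ _ → inj₁ ∈⊤) , ∣⊤∣≡n n)

dominator⇒domNum≡1 : ∀ {n} {D : Digraph n} {w} → Dominator D w → IsDomNum D 1
dominator⇒domNum≡1 {D = D} {w} dominator = (⁅ w ⁆ , dominating , ∣⁅x⁆∣≡1 w) , atLeastOne
  where
  dominating : Dominating D ⁅ w ⁆
  dominating x with dominator x
  ... | inj₁ refl = inj₁ (x∈⁅x⁆ x)
  ... | inj₂ wx   = inj₂ (w , x∈⁅x⁆ w , wx)

  nonempty : ∀ {S : Subset _} {x} → x ∈ S → 1 ≤ ∣ S ∣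
  nonempty x∈S = ≤-trans (s≤s z≤n) (x∈p⇒∣p-x∣<∣p∣ x∈S)

  atLeastOne : ∀ k → HasDomSetOfSize D k → 1 ≤ k
  atLeastOne k (S , S-dominating , refl) with S-dominating w
  ... | inj₁ w∈S           = nonempty w∈S
  ... | inj₂ (_ , u∈S , _) = nonempty u∈S

≤2⇒0⊎1⊎2 : ∀ {k} → k ≤ 2 → k ≡ 0 ⊎ k ≡ 1 ⊎ k ≡ 2
≤2⇒0⊎1⊎2 z≤n             = inj₁ refl
≤2⇒0⊎1⊎2 (s≤s z≤n)       = inj₂ (inj₁ refl)
≤2⇒0⊎1⊎2 (s≤s (s≤s z≤n)) = inj₂ (inj₂ refl)

JointlyDominating : ∀ {n} → Digraph n → Fin n → Fin n → Set
JointlyDominating D u v = ∀ x → x ≡ u ⊎ x ≡ v ⊎ Arc D u x × Arc D v x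

SupportedOn : ∀ {n} → (Fin n → ℕ) → Fin n → Fin n → Set
SupportedOn f u v = ∀ y → y ≢ u → y ≢ v → f y ≡ 0

supportedOn-positive : ∀ {n} {f : Fin n → ℕ} {u v} → SupportedOn f u v →
                       ∀ {y k} → f y ≡ suc k → y ≡ u ⊎ y ≡ v
supportedOn-positive {u = u} {v} supported {y} fy≡1+k with y ≟ u | y ≟ v
... | yes y≡u | _       = inj₁ y≡u
... | no _    | yes y≡v = inj₂ y≡v
... | no y≢u  | no y≢v  = contradiction (trans (sym (supported y y≢u y≢v)) fy≡1+k) λ ()

module _ {n} {D : Digraph n} {f : Fin n → ℕ} (idf : IsIDF D f) where

  supportedOn⇒jointlyDominating : ∀ {u v} → SupportedOn f u v →
    u ≡ v ⊎ f u ≡ 1 × f v ≡ 1 → JointlyDominating D u v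
  supportedOn⇒jointlyDominating {u} {v} supported shape x with x ≟ u | x ≟ v
  ... | yes x≡u | _       = inj₁ x≡u
  ... | no _    | yes x≡v = inj₂ (inj₁ x≡v)
  ... | no x≢u  | no x≢v with proj₂ idf x (supported x x≢u x≢v)
  ...   | inj₁ (y , yx , fy≡2) with supportedOn-positive supported fy≡2 | shape
  ...     | inj₁ refl | inj₁ refl       = inj₂ (inj₂ (yx , yx))
  ...     | inj₁ refl | inj₂ (fu≡1 , _) = contradiction (trans (sym fu≡1) fy≡2) λ ()
  ...     | inj₂ refl | inj₁ refl       = inj₂ (inj₂ (yx , yx))
  ...     | inj₂ refl | inj₂ (_ , fv≡1) = contradiction (trans (sym fv≡1) fy≡2) λ ()
  supportedOn⇒jointlyDominating supported shape x | no _ | no _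
        | inj₂ (y₁ , y₂ , y₁≢y₂ , y₁x , y₂x , fy₁≡1 , fy₂≡1)
        with supportedOn-positive supported fy₁≡1 | supportedOn-positive supported fy₂≡1
  ...     | inj₁ refl | inj₂ refl = inj₂ (inj₂ (y₁x , y₂x))
  ...     | inj₂ refl | inj₁ refl = inj₂ (inj₂ (y₂x , y₁x))
  ...     | inj₁ refl | inj₁ refl = contradiction refl y₁≢y₂
  ...     | inj₂ refl | inj₂ refl = contradiction refl y₁≢y₂

  value2⇒jointlyDominating : sum f ≤ 2 → ∀ {w} → f w ≡ 2 → JointlyDominating D w w
  value2⇒jointlyDominating light {w} fw≡2 = supportedOn⇒jointlyDominating rest-zero (inj₁ refl)
    where
    open ≤-Reasoning
    rest-zero : SupportedOn f w w
    rest-zero y y≢w _ = n≤0⇒n≡0 (+-cancelˡ-≤ 2 _ 0 (begin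
      2 + f y    ≡⟨ cong (_+ f y) fw≡2 ⟨
      f w + f y  ≤⟨ sum-pair-≤ f (y≢w ∘ sym) ⟩
      sum f      ≤⟨ light ⟩
      2          ∎))

  twoValue1⇒jointlyDominating : sum f ≤ 2 → ∀ {u v} → u ≢ v → f u ≡ 1 → f v ≡ 1 →
                               JointlyDominating D u v
  twoValue1⇒jointlyDominating light {u} {v} u≢v fu≡1 fv≡1 =
    supportedOn⇒jointlyDominating rest-zero (inj₂ (fu≡1 , fv≡1))
    where
    open ≤-Reasoning
    rest-zero : SupportedOn f u v
    rest-zero y y≢u y≢v = n≤0⇒n≡0 (+-cancelˡ-≤ 2 _ 0 (begin
      2 + f y            ≡⟨ cong₂ (λ a b → a + (b + f y)) fu≡1 fv≡1 ⟨
      f u + (f v + f y)  ≤⟨ sum-triple-≤ f u≢v (y≢u ∘ sym) (y≢v ∘ sym) ⟩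
      sum f              ≤⟨ light ⟩
      2                  ∎))

  value0⇒jointlyDominating : sum f ≤ 2 → ∀ {p} → f p ≡ 0 →
                                 ∃[ u ] ∃[ v ] JointlyDominating D u v
  value0⇒jointlyDominating light {p} fp≡0 with proj₂ idf p fp≡0
  ... | inj₁ (w , _ , fw≡2) = w , w , value2⇒jointlyDominating light fw≡2
  ... | inj₂ (u , v , u≢v , _ , _ , fu≡1 , fv≡1) =
    u , v , twoValue1⇒jointlyDominating light u≢v fu≡1 fv≡1

  weight≤2⇒jointlyDominating : sum f ≤ 2 → ∀ {p q} → p ≢ q → ∃[ u ] ∃[ v ] JointlyDominating D u v
  weight≤2⇒jointlyDominating light {p} {q} p≢q
    with ≤2⇒0⊎1⊎2 (proj₁ idf p) | ≤2⇒0⊎1⊎2 (proj₁ idf q)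
  ... | inj₁ fp≡0        | _                = value0⇒jointlyDominating light fp≡0
  ... | _                | inj₁ fq≡0        = value0⇒jointlyDominating light fq≡0
  ... | inj₂ (inj₂ fp≡2) | _                = p , p , value2⇒jointlyDominating light fp≡2
  ... | _                | inj₂ (inj₂ fq≡2) = q , q , value2⇒jointlyDominating light fq≡2
  ... | inj₂ (inj₁ fp≡1) | inj₂ (inj₁ fq≡1) = p , q , twoValue1⇒jointlyDominating light p≢q fp≡1 fq≡1

addArc : ∀ {n} → Digraph n → Fin n → Fin n → Digraph n
addArc D u v x y = D x y ∨ (does (x ≟ u) ∧ does (y ≟ v))

module _ {n} (D : Digraph n) {u v : Fin n} where

  addArc-arc : Arc (addArc D u v) u v
  addArc-arc rewrite dec-true (u ≟ u) refl | dec-true (v ≟ v) refl = ∨-zeroʳ (D u v)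

  addArc-off : ∀ {x y} → x ≢ u ⊎ y ≢ v → addArc D u v x y ≡ D x y
  addArc-off {x} {y} (inj₁ x≢u) rewrite dec-false (x ≟ u) x≢u = ∨-identityʳ (D x y)
  addArc-off {x} {y} (inj₂ y≢v)
    rewrite dec-false (y ≟ v) y≢v | ∧-zeroʳ (does (x ≟ u)) = ∨-identityʳ (D x y)

  ⊆ᴰ-addArc : D ⊆ᴰ addArc D u v
  ⊆ᴰ-addArc x y Dxy = cong (_∨ _) Dxy

  addArc-loopless : u ≢ v → Loopless D → Loopless (addArc D u v)
  addArc-loopless u≢v loopless x rewrite loopless x with x ≟ u
  ... | no _     = refl
  ... | yes refl = dec-false (x ≟ v) u≢v

⊆ᴰ-nonArc : ∀ {n} {D₀ D : Digraph n} {u v} → D₀ ⊆ᴰ D → D u v ≡ false → D₀ u v ≡ false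
⊆ᴰ-nonArc {D₀ = D₀} {u = u} {v} D₀⊆D uv≡false with D₀ u v in D₀uv
... | false = refl
... | true  = contradiction (trans (sym uv≡false) (D₀⊆D u v D₀uv)) λ ()

newArc : ∀ {n} → Digraph n → Digraph n → Fin n → Fin n → ℕ
newArc D₀ D x y = if D x y ∧ not (D₀ x y) then 1 else 0

addedArcs≡sum : ∀ {n} (D₀ D : Digraph n) → addedArcs D₀ D ≡ sum (λ x → sum (newArc D₀ D x))
addedArcs≡sum {n} D₀ D = trans (sumFin≡sum n _) (sum-cong-≗ (λ x → sumFin≡sum n (newArc D₀ D x)))

addedArcs-addArc : ∀ {n} {D₀ D : Digraph n} {u v} → D₀ ⊆ᴰ D → D u v ≡ false →
                   addedArcs D₀ (addArc D u v) ≡ addedArcs D₀ D + 1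
addedArcs-addArc {D₀ = D₀} {D} {u} {v} D₀⊆D uv≡false = begin
  addedArcs D₀ D⁺                        ≡⟨ addedArcs≡sum D₀ D⁺ ⟩
  sum (λ x → sum (newArc D₀ D⁺ x))       ≡⟨ sum-suc-at _ _ otherRow rowU ⟩
  suc (sum (λ x → sum (newArc D₀ D x)))  ≡⟨ cong suc (addedArcs≡sum D₀ D) ⟨
  suc (addedArcs D₀ D)                   ≡⟨ +-comm 1 _ ⟩
  addedArcs D₀ D + 1                     ∎
  where
  open ≡-Reasoning
  D⁺ = addArc D u v

  unchanged : ∀ {x y} → x ≢ u ⊎ y ≢ v → newArc D₀ D⁺ x y ≡ newArc D₀ D x y
  unchanged {x} {y} off = cong (λ b → if b ∧ not (D₀ x y) then 1 else 0) (addArc-off D off)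

  otherRow : ∀ x → x ≢ u → sum (newArc D₀ D⁺ x) ≡ sum (newArc D₀ D x)
  otherRow x x≢u = sum-cong-≗ (λ y → unchanged {x} {y} (inj₁ x≢u))

  added : newArc D₀ D⁺ u v ≡ suc (newArc D₀ D u v)
  added rewrite addArc-arc D {u} {v} | uv≡false | ⊆ᴰ-nonArc D₀⊆D uv≡false = refl

  rowU : sum (newArc D₀ D⁺ u) ≡ suc (sum (newArc D₀ D u))
  rowU = sum-suc-at _ _ (λ y y≢v → unchanged {u} {y} (inj₂ y≢v)) added

jointlyDominating-mono : ∀ {n} {D D' : Digraph n} {u v} → D ⊆ᴰ D' →
                         JointlyDominating D u v → JointlyDominating D' u v
jointlyDominating-mono D⊆D' joint x with joint x
... | inj₁ x≡u              = inj₁ x≡u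
... | inj₂ (inj₁ x≡v)       = inj₂ (inj₁ x≡v)
... | inj₂ (inj₂ (ux , vx)) = inj₂ (inj₂ (D⊆D' _ x ux , D⊆D' _ x vx))

jointlyDominating⇒dominator : ∀ {n} {D : Digraph n} {u v} → JointlyDominating D u v →
                              u ≡ v ⊎ Arc D u v → Dominator D u
jointlyDominating⇒dominator joint u≡v⊎uv x with joint x
... | inj₁ x≡u             = inj₁ x≡u
... | inj₂ (inj₂ (ux , _)) = inj₂ ux
... | inj₂ (inj₁ refl) with u≡v⊎uv
...   | inj₁ u≡x = inj₁ (sym u≡x)
...   | inj₂ ux  = inj₂ ux

extendToDominator : ∀ {n} {D₀ D : Digraph n} {m u v} → IsExtension D₀ D m →
  JointlyDominating D u v → ∃[ D' ] ∃[ m' ] (IsExtension D₀ D' m' × m' ≤ m + 1 × ∃[ w ] Dominator D' w)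
extendToDominator {D = D} {m} {u} {v} ext@(loopless , D₀⊆D , added≡m) joint
  with u ≟ v | D u v in uv
... | yes u≡v | _    = D , m , ext , m≤m+n m 1 , u , jointlyDominating⇒dominator joint (inj₁ u≡v)
... | no _    | true = D , m , ext , m≤m+n m 1 , u , jointlyDominating⇒dominator joint (inj₂ uv)
... | no u≢v  | false =
  addArc D u v , m + 1 ,
  (addArc-loopless D u≢v loopless , (λ x y → D⊆D⁺ x y ∘ D₀⊆D x y) ,
   trans (addedArcs-addArc D₀⊆D uv) (cong (_+ 1) added≡m)) ,
  ≤-refl , u ,
  jointlyDominating⇒dominator {D = addArc D u v}
    (jointlyDominating-mono D⊆D⁺ joint) (inj₂ (addArc-arc D))
  where
  D⊆D⁺ : D ⊆ᴰ addArc D u v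
  D⊆D⁺ = ⊆ᴰ-addArc D

distinctVertices : ∀ {n} → 2 ≤ n → ∃₂ λ (p q : Fin n) → p ≢ q
distinctVertices {suc (suc _)} (s≤s (s≤s _)) = zero , suc zero , λ ()

italReinf⇒lightExtension : ∀ {n} {D : Digraph n} {rI} → IsItalNum D 3 → IsItalReinfNum D rI →
  ∃[ D' ] ∃[ f ] (IsExtension D D' rI × IsIDF D' f × sum f ≤ 2)
italReinf⇒lightExtension γI≡3 (inj₁ (g , γI≡g , g≤2 , _)) =
  contradiction (subst (_≤ 2) (IsMin-unique γI≡g γI≡3) g≤2) λ { (s≤s (s≤s ())) }
italReinf⇒lightExtension {n} γI≡3
  (inj₂ (g , γI≡g , _ , ((D' , extension , a , ((f , idf , weight≡a) , _) , a<g) , _))) =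
  D' , f , extension , idf , ≤-pred (begin-strict
    sum f     ≡⟨ sumFin≡sum n f ⟨
    weight f  ≡⟨ weight≡a ⟩
    a         <⟨ a<g ⟩
    g         ≡⟨ IsMin-unique γI≡g γI≡3 ⟩
    3         ∎)
  where open ≤-Reasoning

theorem4p5 : ∀ (n : ℕ) (D : Digraph n) → Loopless D →
    IsItalNum D 3 → IsDomNum D 2 →
    ∀ (r rI : ℕ) → IsReinfNum D r → IsItalReinfNum D rI →
    r ≤ rI + 1
theorem4p5 n D _ γI≡3 γ≡2 r rI (_ , r-min) italReinf
  with italReinf⇒lightExtension γI≡3 italReinf | distinctVertices (domNum-≤-order γ≡2)
... | D' , f , extension , idf , light | p , q , p≢q
  with weight≤2⇒jointlyDominating idf light p≢q
... | u , v , joint with extendToDominator extension joint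
... | D'' , m , extension' , m≤rI+1 , w , dominator =
  ≤-trans (r-min m (D'' , extension' , 1 , 2 , dominator⇒domNum≡1 dominator , γ≡2 , ≤-refl)) m≤rI+1
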